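{- Let $\mathcal{R}$ be a commutative Frobenius ring of characteristic $2$, let $n\ge 1$, let $A$ and $B$ be $n\times n$ circulant matrices over $\mathcal{R}$, and let $C$ be an $n\times n$ reverse circulant matrix over $\mathcal{R}$. Suppose that $AA^{T}+BB^{T}+C^{2}=I_{n}$ and $AC=CA$. Then the code of length $4n$ over $\mathcal{R}$ generated by the rows of the $2n\times 4n$ matrix $$G=\left( I_{2n}\ \middle|\ \begin{array}{cc} A & B+C \\ B^{T}+C & A^{T}\end{array}\right)$$ is self-dual.
   Context: A code of length $N$ over $\mathcal{R}$ is an $\mathcal{R}$-submodule of $\mathcal{R}^N$; the code generated by a matrix is the $\mathcal{R}$-submodule spanned by its rows. Duality is with respect to the Euclidean inner product $\langle x,y\rangle=\sum_i x_iy_i$, and a code $\mathcal{C}$ is self-dual if $\mathcal{C}=\mathcal{C}^\perp$, where $\mathcal{C}^\perp=\{x\in\mathcal{R}^N:\langle x,y\rangle=0 \text{ for all } y\in\mathcal{C}\}$. An $n\times n$ matrix is circulant if each row is the right cyclic shift of the previous row, i.e. if its first row is $(a_1,\dots,a_n)$ then row $i+1$ is $\sigma^{i}(a_1,\dots,a_n)$ where $\sigma(a_1,\dots,a_n)=(a_n,a_1,\dots,a_{n-1})$. An $n\times n$ matrix is reverse circulant if each row is the left cyclic shift of the previous row, i.e. row $i+1$ is $\sigma^{ -i}$ applied to the first row. -}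

module Defs where

open import Level using (Level; _⊔_) renaming (suc to lsuc)
open import Algebra.Bundles using (CommutativeRing)
open import Data.Nat using (ℕ; zero; suc; NonZero) renaming (_+_ to _+ℕ_; _∸_ to _∸ℕ_)
open import Data.Nat.DivMod using (_mod_)
open import Data.Fin using (Fin; toℕ; splitAt; _≟_)
open import Data.Sum using (_⊎_; inj₁; inj₂)
open import Data.Product using (Σ; ∃; ∃-syntax; _×_; _,_)
open import Relation.Nullary using (¬_; yes; no)
open import Function using (_⇔_)

module _ {c ℓ : Level} (R : CommutativeRing c ℓ) where
  open CommutativeRing R
  open import Algebra.Definitions.RawMonoid +-rawMonoid using (sum)

  Pred : Set (lsuc (c ⊔ ℓ))
  Pred = Carrier → Set (c ⊔ ℓ)

  _⊆_ : Pred → Pred → Set (c ⊔ ℓ)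
  I ⊆ J = ∀ x → I x → J x

  record IsIdeal (I : Pred) : Set (c ⊔ ℓ) where
    field
      resp : ∀ {x y} → x ≈ y → I x → I y
      has-0 : I 0#
      +-closed : ∀ {x y} → I x → I y → I (x + y)
      *-closed : ∀ r {x} → I x → I (r * x)

  IsMaximal : Pred → Set (lsuc (c ⊔ ℓ))
  IsMaximal M = IsIdeal M × ¬ M 1#
    × (∀ (I : Pred) → IsIdeal I → M ⊆ I → (I ⊆ M) ⊎ I 1#)

  IsMinimal : Pred → Set (lsuc (c ⊔ ℓ))
  IsMinimal I = IsIdeal I × (∃[ x ] (I x × ¬ (x ≈ 0#)))
    × (∀ (K : Pred) → IsIdeal K → K ⊆ I → (∀ x → K x → x ≈ 0#) ⊎ (I ⊆ K))

  Jac : Carrier → Set (lsuc (c ⊔ ℓ))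
  Jac x = ∀ (M : Pred) → IsMaximal M → M x

  Soc : Carrier → Set (lsuc (c ⊔ ℓ))
  Soc x = ∃[ k ] Σ (Fin k → Carrier) λ v → Σ (Fin k → Pred) λ I →
            (∀ t → IsMinimal (I t) × I t (v t)) × (x ≈ sum v)

  IsFinite : Set (c ⊔ ℓ)
  IsFinite = ∃[ N ] Σ (Fin N → Carrier) λ e → ∀ x → ∃[ i ] (e i ≈ x)

  -- R is a (finite, commutative) Frobenius ring: soc(R) ≅ R/J(R) as R-modules,
  -- expressed as an R-linear surjection R → soc(R) with kernel J(R).
  IsFrobenius : Set (lsuc (c ⊔ ℓ))
  IsFrobenius = IsFinite × Σ (Carrier → Carrier) λ f →
      (∀ {x y} → x ≈ y → f x ≈ f y)
    × (∀ x y → f (x + y) ≈ f x + f y)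
    × (∀ r x → f (r * x) ≈ r * f x)
    × (∀ x → Soc (f x))
    × (∀ y → Soc y → ∃[ x ] (f x ≈ y))
    × (∀ x → (f x ≈ 0# → Jac x) × (Jac x → f x ≈ 0#))

  Characteristic2 : Set ℓ
  Characteristic2 = 1# + 1# ≈ 0#

  Mat : ℕ → ℕ → Set c
  Mat m n = Fin m → Fin n → Carrier

  Vect : ℕ → Set c
  Vect n = Fin n → Carrier

  _ᵀ : ∀ {m n} → Mat m n → Mat n m
  (M ᵀ) i j = M j i

  infixl 7 _·_
  _·_ : ∀ {m n p} → Mat m n → Mat n p → Mat m p
  (M · N) i j = sum (λ k → M i k * N k j)

  infixl 6 _⊕_
  _⊕_ : ∀ {m n} → Mat m n → Mat m n → Mat m n
  (M ⊕ N) i j = M i j + N i j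

  Id : ∀ n → Mat n n
  Id n i j with i ≟ j
  ... | yes _ = 1#
  ... | no _ = 0#

  _≈ᴹ_ : ∀ {m n} → Mat m n → Mat m n → Set ℓ
  M ≈ᴹ N = ∀ i j → M i j ≈ N i j

  -- circulant: row i is σ^i (first row), i.e. entry (i,j) = a_{(j - i) mod n}
  IsCirculant : ∀ n .{{_ : NonZero n}} → Mat n n → Set (c ⊔ ℓ)
  IsCirculant n M = Σ (Vect n) λ a →
    ∀ (i j : Fin n) → M i j ≈ a ((toℕ j +ℕ (n ∸ℕ toℕ i)) mod n)

  -- reverse circulant: row i is σ^{-i} (first row), i.e. entry (i,j) = a_{(j + i) mod n}
  IsReverseCirculant : ∀ n .{{_ : NonZero n}} → Mat n n → Set (c ⊔ ℓ)
  IsReverseCirculant n M = Σ (Vect n) λ a →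
    ∀ (i j : Fin n) → M i j ≈ a ((toℕ j +ℕ toℕ i) mod n)

  genMat : ∀ n → (A B C : Mat n n) → Mat (n +ℕ n) ((n +ℕ n) +ℕ (n +ℕ n))
  genMat n A B C i j with splitAt (n +ℕ n) j
  ... | inj₁ j' = Id (n +ℕ n) i j'
  ... | inj₂ j' with splitAt n i | splitAt n j'
  ... | inj₁ r | inj₁ s = A r s
  ... | inj₁ r | inj₂ s = (B ⊕ C) r s
  ... | inj₂ r | inj₁ s = ((B ᵀ) ⊕ C) r s
  ... | inj₂ r | inj₂ s = (A ᵀ) r s

  ⟨_,_⟩ : ∀ {N} → Vect N → Vect N → Carrier
  ⟨ x , y ⟩ = sum (λ i → x i * y i)

  Code : ℕ → Set (lsuc (c ⊔ ℓ))
  Code N = Vect N → Set (c ⊔ ℓ)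

  rowSpan : ∀ {k N} → Mat k N → Code N
  rowSpan {k} G x = Σ (Vect k) λ λs → ∀ j → x j ≈ sum (λ i → λs i * G i j)

  dual : ∀ {N} → Code N → Code N
  dual {N} 𝒞 x = ∀ (y : Vect N) → 𝒞 y → ⟨ x , y ⟩ ≈ 0#

  IsSelfDual : ∀ {N} → Code N → Set (c ⊔ ℓ)
  IsSelfDual {N} 𝒞 = ∀ (x : Vect N) → (𝒞 x → dual 𝒞 x) × (dual 𝒞 x → 𝒞 x)

-- Write G = (I | M) with M = [[A , B + C] , [Bᵀ + C , Aᵀ]]. In characteristic 2,
-- M Mᵀ = I makes the rows of G pairwise orthogonal (G Gᵀ = I + M Mᵀ = 2I = 0),
-- and Mᵀ M = I lets every vector x orthogonal to the rows be rebuilt as the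
-- combination of the rows whose coefficients are the first half of x.
-- Circulant matrices commute with each other and with their transposes, a
-- reverse circulant C is symmetric, and so is B C for B circulant. Expanding
-- M Mᵀ blockwise, every cross term therefore occurs twice and vanishes, and the
-- diagonal blocks reduce to A Aᵀ + B Bᵀ + C² = I. Since Mᵀ is the matrix M
-- built from Aᵀ, which satisfies the same hypotheses, Mᵀ M = I as well.

module Submission where

open import Level using (Level; 0ℓ)
open import Algebra.Bundles using (CommutativeRing)
open import Data.Nat using (ℕ; zero; suc; NonZero) renaming (_+_ to _+ℕ_)
open import Data.Fin using (Fin; zero; suc; toℕ; _↑ˡ_; _↑ʳ_; splitAt; _≟_)
open import Data.Fin.Permutation using (permutation)
open import Data.Fin.Properties using (↑ˡ-injective; ↑ʳ-injective; splitAt-↑ˡ; splitAt-↑ʳ; splitAt⁻¹-↑ˡ; splitAt⁻¹-↑ʳ; suc-injective)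
open import Data.Sum using (inj₁; inj₂)
open import Data.Product using (_,_)
open import Data.Empty using (⊥-elim)
open import Relation.Nullary using (Dec; yes; no)
open import Relation.Binary.Bundles using (Setoid)
open import Relation.Binary.PropositionalEquality as ≡ using (_≡_; _≢_)
import Relation.Binary.Reasoning.Setoid as SetoidReasoning
import Defs as D

module Residues (n : ℕ) .{{_ : NonZero n}} where
  open import Data.Nat using (_+_; _∸_; _%_)
  open import Data.Nat.Properties using (+-assoc; +-comm; +-identityʳ; m∸n+n≡m; <⇒≤)
  open import Data.Nat.DivMod using (_mod_; %-distribˡ-+; m%n%n≡m%n; n%n≡0; m*n%n≡0; m%n<n; m<n⇒m%n≡m)
  open import Data.Nat.Solver using (module +-*-Solver)
  open import Data.Fin.Properties using (toℕ-fromℕ<; toℕ-injective; toℕ<n)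
  open import Relation.Binary.PropositionalEquality using (refl; sym; trans; cong; cong₂)
  open +-*-Solver using (solve; _:+_; _:=_)

  infix 4 _≡ₘ_
  record _≡ₘ_ (a b : ℕ) : Set where
    constructor mod-≡
    field %-≡ : a % n ≡ b % n
  open _≡ₘ_

  ≡ₘ-setoid : Setoid 0ℓ 0ℓ
  ≡ₘ-setoid = record
    { Carrier = ℕ
    ; _≈_ = _≡ₘ_
    ; isEquivalence = record
      { refl = mod-≡ refl
      ; sym = λ p → mod-≡ (sym (%-≡ p))
      ; trans = λ p q → mod-≡ (trans (%-≡ p) (%-≡ q))
      }
    }
  open Setoid ≡ₘ-setoid using () renaming (refl to ≡ₘ-refl)
  open import Relation.Binary.Reasoning.Setoid ≡ₘ-setoid

  +-cong-≡ₘ : ∀ {a a′ b b′} → a ≡ₘ a′ → b ≡ₘ b′ → a + b ≡ₘ a′ + b′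
  +-cong-≡ₘ {a} {a′} {b} {b′} (mod-≡ p) (mod-≡ q) = mod-≡ (trans (%-distribˡ-+ a b n)
    (trans (cong₂ (λ x y → (x + y) % n) p q) (sym (%-distribˡ-+ a′ b′ n))))

  +-congˡ-≡ₘ : ∀ a {b b′} → b ≡ₘ b′ → a + b ≡ₘ a + b′
  +-congˡ-≡ₘ a = +-cong-≡ₘ (≡ₘ-refl {a})

  +-congʳ-≡ₘ : ∀ {a a′} b → a ≡ₘ a′ → a + b ≡ₘ a′ + b
  +-congʳ-≡ₘ b p = +-cong-≡ₘ p (≡ₘ-refl {b})

  [_] : ℕ → Fin n
  [ a ] = a mod n

  toℕ-[] : ∀ a → toℕ [ a ] ≡ₘ a
  toℕ-[] a = mod-≡ (trans (cong (_% n) (toℕ-fromℕ< (m%n<n a n))) (m%n%n≡m%n a n))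

  []-cong : ∀ {a b} → a ≡ₘ b → [ a ] ≡ [ b ]
  []-cong {a} {b} (mod-≡ p) =
    toℕ-injective (trans (toℕ-fromℕ< (m%n<n a n)) (trans p (sym (toℕ-fromℕ< (m%n<n b n)))))

  [toℕ] : ∀ i → [ toℕ i ] ≡ i
  [toℕ] i = toℕ-injective (trans (toℕ-fromℕ< (m%n<n (toℕ i) n)) (m<n⇒m%n≡m (toℕ<n i)))

  -- n ∸ toℕ i never truncates (toℕ i < n): it represents − i modulo n.
  neg : Fin n → ℕ
  neg i = n ∸ toℕ i

  neg-inverse : ∀ i → neg i + toℕ i ≡ₘ 0
  neg-inverse i = mod-≡ (trans (cong (_% n) (m∸n+n≡m (<⇒≤ (toℕ<n i)))) (trans (n%n≡0 n) (sym (m*n%n≡0 0 n))))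

  +-inverseʳ : ∀ a i → a + (neg i + toℕ i) ≡ₘ a
  +-inverseʳ a i = begin
    a + (neg i + toℕ i) ≈⟨ +-congˡ-≡ₘ a (neg-inverse i) ⟩
    a + 0               ≡⟨ +-identityʳ a ⟩
    a                   ∎

  +-cancelʳ-≡ₘ : ∀ {a b} i → a + toℕ i ≡ₘ b + toℕ i → a ≡ₘ b
  +-cancelʳ-≡ₘ {a} {b} i p = begin
    a                         ≈⟨ +-inverseʳ a i ⟨
    a + (neg i + toℕ i)       ≡⟨ solve 3 (λ a x y → a :+ (x :+ y) := (a :+ y) :+ x) refl a (neg i) (toℕ i) ⟩
    (a + toℕ i) + neg i       ≈⟨ +-congʳ-≡ₘ (neg i) p ⟩
    (b + toℕ i) + neg i       ≡⟨ solve 3 (λ b x y → (b :+ y) :+ x := b :+ (x :+ y)) refl b (neg i) (toℕ i) ⟩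
    b + (neg i + toℕ i)       ≈⟨ +-inverseʳ b i ⟩
    b                         ∎

  -- (i + j) mod n and (j − i) mod n, spelled as in IsReverseCirculant and IsCirculant,
  -- so that those hypotheses read M i j ≈ c (j ⊞ i) and M i j ≈ a (j ⊟ i).
  infixl 6 _⊞_ _⊟_
  _⊞_ : Fin n → Fin n → Fin n
  i ⊞ j = [ toℕ i + toℕ j ]

  _⊟_ : Fin n → Fin n → Fin n
  j ⊟ i = [ toℕ j + neg i ]

  ⊞-comm : ∀ i j → i ⊞ j ≡ j ⊞ i
  ⊞-comm i j = cong [_] (+-comm (toℕ i) (toℕ j))

  ⊟-anticomm : ∀ i j → i ⊟ j ≡ [ neg (j ⊟ i) ]
  ⊟-anticomm i j = []-cong (+-cancelʳ-≡ₘ (j ⊟ i) (begin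
    toℕ i + neg j + toℕ (j ⊟ i)             ≈⟨ +-congˡ-≡ₘ (toℕ i + neg j) (toℕ-[] (toℕ j + neg i)) ⟩
    toℕ i + neg j + (toℕ j + neg i)
      ≡⟨ solve 4 (λ i i′ j j′ → i :+ j′ :+ (j :+ i′) := (j′ :+ j) :+ (i′ :+ i)) refl (toℕ i) (neg i) (toℕ j) (neg j) ⟩
    (neg j + toℕ j) + (neg i + toℕ i)       ≈⟨ +-inverseʳ (neg j + toℕ j) i ⟩
    neg j + toℕ j                           ≈⟨ neg-inverse j ⟩
    0                                       ≈⟨ neg-inverse (j ⊟ i) ⟨
    neg (j ⊟ i) + toℕ (j ⊟ i)               ∎))

  reflect : Fin n → Fin n → Fin n → Fin n
  reflect i j t = [ toℕ i + toℕ j + neg t ]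

  reflect-⊟ˡ : ∀ i j t → reflect i j t ⊟ i ≡ j ⊟ t
  reflect-⊟ˡ i j t = []-cong (begin
    toℕ (reflect i j t) + neg i           ≈⟨ +-congʳ-≡ₘ (neg i) (toℕ-[] (toℕ i + toℕ j + neg t)) ⟩
    toℕ i + toℕ j + neg t + neg i
      ≡⟨ solve 4 (λ i i′ j t′ → i :+ j :+ t′ :+ i′ := (j :+ t′) :+ (i′ :+ i)) refl (toℕ i) (neg i) (toℕ j) (neg t) ⟩
    (toℕ j + neg t) + (neg i + toℕ i)     ≈⟨ +-inverseʳ (toℕ j + neg t) i ⟩
    toℕ j + neg t                         ∎)

  reflect-⊟ʳ : ∀ i j t → j ⊟ reflect i j t ≡ t ⊟ i
  reflect-⊟ʳ i j t = []-cong (+-cancelʳ-≡ₘ ρ (begin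
    toℕ j + neg ρ + toℕ ρ                 ≡⟨ +-assoc (toℕ j) (neg ρ) (toℕ ρ) ⟩
    toℕ j + (neg ρ + toℕ ρ)               ≈⟨ +-inverseʳ (toℕ j) ρ ⟩
    toℕ j                                 ≈⟨ +-inverseʳ (toℕ j) t ⟨
    toℕ j + (neg t + toℕ t)               ≈⟨ +-inverseʳ (toℕ j + (neg t + toℕ t)) i ⟨
    toℕ j + (neg t + toℕ t) + (neg i + toℕ i)
      ≡⟨ solve 5 (λ i i′ j t t′ → j :+ (t′ :+ t) :+ (i′ :+ i) := t :+ i′ :+ (i :+ j :+ t′)) refl (toℕ i) (neg i) (toℕ j) (toℕ t) (neg t) ⟩
    toℕ t + neg i + (toℕ i + toℕ j + neg t) ≈⟨ +-congˡ-≡ₘ (toℕ t + neg i) (toℕ-[] (toℕ i + toℕ j + neg t)) ⟨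
    toℕ t + neg i + toℕ ρ                 ∎))
    where ρ = reflect i j t

  reflect-involutive : ∀ i j t → reflect i j (reflect i j t) ≡ t
  reflect-involutive i j t = trans ([]-cong (+-cancelʳ-≡ₘ ρ (begin
    toℕ i + toℕ j + neg ρ + toℕ ρ         ≡⟨ +-assoc (toℕ i + toℕ j) (neg ρ) (toℕ ρ) ⟩
    toℕ i + toℕ j + (neg ρ + toℕ ρ)       ≈⟨ +-inverseʳ (toℕ i + toℕ j) ρ ⟩
    toℕ i + toℕ j                         ≈⟨ +-inverseʳ (toℕ i + toℕ j) t ⟨
    toℕ i + toℕ j + (neg t + toℕ t)
      ≡⟨ solve 4 (λ i j t t′ → i :+ j :+ (t′ :+ t) := t :+ (i :+ j :+ t′)) refl (toℕ i) (toℕ j) (toℕ t) (neg t) ⟩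
    toℕ t + (toℕ i + toℕ j + neg t)       ≈⟨ +-congˡ-≡ₘ (toℕ t) (toℕ-[] (toℕ i + toℕ j + neg t)) ⟨
    toℕ t + toℕ ρ                         ∎))) ([toℕ] t)
    where ρ = reflect i j t

  translate : Fin n → Fin n → Fin n → Fin n
  translate i j t = [ toℕ t + toℕ j + neg i ]

  translate-inverse : ∀ i j t → translate j i (translate i j t) ≡ t
  translate-inverse i j t = trans ([]-cong (begin
    toℕ (translate i j t) + toℕ i + neg j
      ≈⟨ +-congʳ-≡ₘ (neg j) (+-congʳ-≡ₘ (toℕ i) (toℕ-[] (toℕ t + toℕ j + neg i))) ⟩
    toℕ t + toℕ j + neg i + toℕ i + neg j
      ≡⟨ solve 5 (λ i i′ j j′ t → t :+ j :+ i′ :+ i :+ j′ := t :+ (i′ :+ i) :+ (j′ :+ j)) refl (toℕ i) (neg i) (toℕ j) (neg j) (toℕ t) ⟩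
    toℕ t + (neg i + toℕ i) + (neg j + toℕ j) ≈⟨ +-inverseʳ (toℕ t + (neg i + toℕ i)) j ⟩
    toℕ t + (neg i + toℕ i)               ≈⟨ +-inverseʳ (toℕ t) i ⟩
    toℕ t                                 ∎)) ([toℕ] t)

  translate-⊟ : ∀ i j t → translate i j t ⊟ j ≡ t ⊟ i
  translate-⊟ i j t = []-cong (begin
    toℕ (translate i j t) + neg j         ≈⟨ +-congʳ-≡ₘ (neg j) (toℕ-[] (toℕ t + toℕ j + neg i)) ⟩
    toℕ t + toℕ j + neg i + neg j
      ≡⟨ solve 4 (λ i′ j j′ t → t :+ j :+ i′ :+ j′ := (t :+ i′) :+ (j′ :+ j)) refl (neg i) (toℕ j) (neg j) (toℕ t) ⟩
    toℕ t + neg i + (neg j + toℕ j)       ≈⟨ +-inverseʳ (toℕ t + neg i) j ⟩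
    toℕ t + neg i                         ∎)

  translate-⊞ : ∀ i j t → i ⊞ translate i j t ≡ j ⊞ t
  translate-⊞ i j t = []-cong (begin
    toℕ i + toℕ (translate i j t)         ≈⟨ +-congˡ-≡ₘ (toℕ i) (toℕ-[] (toℕ t + toℕ j + neg i)) ⟩
    toℕ i + (toℕ t + toℕ j + neg i)
      ≡⟨ solve 4 (λ i i′ j t → i :+ (t :+ j :+ i′) := (j :+ t) :+ (i′ :+ i)) refl (toℕ i) (neg i) (toℕ j) (toℕ t) ⟩
    toℕ j + toℕ t + (neg i + toℕ i)       ≈⟨ +-inverseʳ (toℕ j + toℕ t) i ⟩
    toℕ j + toℕ t                         ∎)

module Matrices {c ℓ : Level} (R : CommutativeRing c ℓ) where
  open CommutativeRing R hiding (zero)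
  open import Algebra.Properties.CommutativeSemigroup *-commutativeSemigroup using (x∙yz≈y∙xz)
  open import Algebra.Properties.Semiring.Sum semiring using (sum; sum-cong-≋; sum-cong-≗; sum-replicate-zero; ∑-comm; ∑-permute; *-distribˡ-sum; *-distribʳ-sum; ∑-distrib-+)

  Mat : ℕ → ℕ → Set c
  Mat = D.Mat R

  infixl 7 _·_
  _·_ : ∀ {m n p} → Mat m n → Mat n p → Mat m p
  _·_ = D._·_ R

  infixl 6 _⊕_
  _⊕_ : ∀ {m n} → Mat m n → Mat m n → Mat m n
  _⊕_ = D._⊕_ R

  infix 10 _ᵀ
  _ᵀ : ∀ {m n} → Mat m n → Mat n m
  _ᵀ = D._ᵀ R

  Id : ∀ n → Mat n n
  Id = D.Id R

  𝟎 : ∀ {m n} → Mat m n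
  𝟎 _ _ = 0#

  infix 4 _≋_
  _≋_ : ∀ {m n} → Mat m n → Mat m n → Set ℓ
  _≋_ = D._≈ᴹ_ R

  ⟨_,_⟩ : ∀ {n} → D.Vect R n → D.Vect R n → Carrier
  ⟨_,_⟩ = D.⟨_,_⟩ R

  Symmetric : ∀ {n} → Mat n n → Set ℓ
  Symmetric X = X ᵀ ≋ X

  ≋-setoid : ℕ → ℕ → Setoid c ℓ
  ≋-setoid m n = record
    { Carrier = Mat m n
    ; _≈_ = _≋_
    ; isEquivalence = record
      { refl = λ _ _ → refl
      ; sym = λ p i j → sym (p i j)
      ; trans = λ p q i j → trans (p i j) (q i j)
      }
    }

  ≋-refl : ∀ {m n} {X : Mat m n} → X ≋ X
  ≋-refl = Setoid.refl (≋-setoid _ _)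

  ≋-sym : ∀ {m n} {X Y : Mat m n} → X ≋ Y → Y ≋ X
  ≋-sym = Setoid.sym (≋-setoid _ _)

  ≋-trans : ∀ {m n} {X Y Z : Mat m n} → X ≋ Y → Y ≋ Z → X ≋ Z
  ≋-trans = Setoid.trans (≋-setoid _ _)

  module ≋-Reasoning {m n : ℕ} = SetoidReasoning (≋-setoid m n)
  module ≈-Reasoning = SetoidReasoning setoid

  sum-zero : ∀ {n} (f : Fin n → Carrier) → (∀ i → f i ≈ 0#) → sum f ≈ 0#
  sum-zero {n} f f≈0 = trans (sum-cong-≋ f≈0) (sum-replicate-zero n)

  sum-↑ : ∀ m {n} (f : Fin (m +ℕ n) → Carrier) →
          sum f ≈ sum (λ i → f (i ↑ˡ n)) + sum (λ i → f (m ↑ʳ i))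
  sum-↑ zero f = sym (+-identityˡ _)
  sum-↑ (suc m) f = trans (+-congˡ (sum-↑ m (λ i → f (suc i)))) (sym (+-assoc _ _ _))

  Id-diag : ∀ {n} (i : Fin n) → Id n i i ≡ 1#
  Id-diag i with i ≟ i
  ... | yes _ = ≡.refl
  ... | no i≢i = ⊥-elim (i≢i ≡.refl)

  Id-offdiag : ∀ {n} {i j : Fin n} → i ≢ j → Id n i j ≡ 0#
  Id-offdiag {i = i} {j} i≢j with i ≟ j
  ... | yes i≡j = ⊥-elim (i≢j i≡j)
  ... | no _ = ≡.refl

  Id-reindex : ∀ {m n} (f : Fin m → Fin n) → (∀ i j → f i ≡ f j → i ≡ j) →
               ∀ i j → Id n (f i) (f j) ≡ Id m i j
  Id-reindex f f-injective i j = by-cases (i ≟ j)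
    where
    by-cases : Dec (i ≡ j) → Id _ (f i) (f j) ≡ Id _ i j
    by-cases (yes ≡.refl) = ≡.trans (Id-diag (f i)) (≡.sym (Id-diag i))
    by-cases (no i≢j) = ≡.trans (Id-offdiag (λ fi≡fj → i≢j (f-injective i j fi≡fj))) (≡.sym (Id-offdiag i≢j))

  Id-symmetric : ∀ {n} (i j : Fin n) → Id n i j ≡ Id n j i
  Id-symmetric i j = by-cases (i ≟ j)
    where
    by-cases : Dec (i ≡ j) → Id _ i j ≡ Id _ j i
    by-cases (yes ≡.refl) = ≡.refl
    by-cases (no i≢j) = ≡.trans (Id-offdiag i≢j) (≡.sym (Id-offdiag (λ j≡i → i≢j (≡.sym j≡i))))

  sum-Idˡ : ∀ {n} (i : Fin n) (f : Fin n → Carrier) → sum (λ l → Id n i l * f l) ≈ f i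
  sum-Idˡ {suc n} zero f = begin
    Id (suc n) zero zero * f zero + sum (λ l → Id (suc n) zero (suc l) * f (suc l))
      ≈⟨ +-cong (*-congʳ (reflexive (Id-diag {suc n} zero)))
                (sum-zero (λ l → Id (suc n) zero (suc l) * f (suc l))
                          (λ l → trans (*-congʳ (reflexive (Id-offdiag {i = zero} {suc l} (λ ())))) (zeroˡ _))) ⟩
    1# * f zero + 0#  ≈⟨ +-identityʳ _ ⟩
    1# * f zero       ≈⟨ *-identityˡ _ ⟩
    f zero            ∎
    where open ≈-Reasoning
  sum-Idˡ {suc n} (suc i) f = begin
    Id (suc n) (suc i) zero * f zero + sum (λ l → Id (suc n) (suc i) (suc l) * f (suc l))
      ≈⟨ +-cong (*-congʳ (reflexive (Id-offdiag {i = suc i} {zero} (λ ()))))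
                (sum-cong-≋ (λ l → *-congʳ (reflexive (Id-reindex suc (λ _ _ → suc-injective) i l)))) ⟩
    0# * f zero + sum (λ l → Id n i l * f (suc l)) ≈⟨ +-congʳ (zeroˡ _) ⟩
    0# + sum (λ l → Id n i l * f (suc l))          ≈⟨ +-identityˡ _ ⟩
    sum (λ l → Id n i l * f (suc l))               ≈⟨ sum-Idˡ i (λ l → f (suc l)) ⟩
    f (suc i)                                      ∎
    where open ≈-Reasoning

  sum-Idʳ : ∀ {n} (i : Fin n) (f : Fin n → Carrier) → sum (λ l → f l * Id n l i) ≈ f i
  sum-Idʳ i f = trans (sum-cong-≋ (λ l → trans (*-comm _ _) (*-congʳ (reflexive (Id-symmetric l i))))) (sum-Idˡ i f)

  ·-cong : ∀ {m n p} {X X′ : Mat m n} {Y Y′ : Mat n p} → X ≋ X′ → Y ≋ Y′ → X · Y ≋ X′ · Y′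
  ·-cong X≋X′ Y≋Y′ i j = sum-cong-≋ (λ t → *-cong (X≋X′ i t) (Y≋Y′ t j))

  ⊕-cong : ∀ {m n} {X X′ Y Y′ : Mat m n} → X ≋ X′ → Y ≋ Y′ → X ⊕ Y ≋ X′ ⊕ Y′
  ⊕-cong X≋X′ Y≋Y′ i j = +-cong (X≋X′ i j) (Y≋Y′ i j)

  ⊕-comm : ∀ {m n} (X Y : Mat m n) → X ⊕ Y ≋ Y ⊕ X
  ⊕-comm X Y i j = +-comm (X i j) (Y i j)

  ·-distribˡ-⊕ : ∀ {m n p} (X : Mat m n) (Y Z : Mat n p) → X · (Y ⊕ Z) ≋ X · Y ⊕ X · Z
  ·-distribˡ-⊕ {n = n} X Y Z i j = trans (sum-cong-≋ {n} (λ t → distribˡ (X i t) (Y t j) (Z t j)))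
                                         (∑-distrib-+ (λ t → X i t * Y t j) (λ t → X i t * Z t j))

  ·-distribʳ-⊕ : ∀ {m n p} (X : Mat n p) (Y Z : Mat m n) → (Y ⊕ Z) · X ≋ Y · X ⊕ Z · X
  ·-distribʳ-⊕ {n = n} X Y Z i j = trans (sum-cong-≋ {n} (λ t → distribʳ (X t j) (Y i t) (Z i t)))
                                         (∑-distrib-+ (λ t → Y i t * X t j) (λ t → Z i t * X t j))

  ᵀ-· : ∀ {m n p} (X : Mat m n) (Y : Mat n p) → (X · Y) ᵀ ≋ Y ᵀ · X ᵀ
  ᵀ-· X Y i j = sum-cong-≋ (λ t → *-comm (X j t) (Y t i))

  ·-comm-⊕ : ∀ {n} {X Y Z : Mat n n} → X · Y ≋ Y · X → X · Z ≋ Z · X → X · (Y ⊕ Z) ≋ (Y ⊕ Z) · X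
  ·-comm-⊕ {X = X} {Y} {Z} XY≋YX XZ≋ZX = begin
    X · (Y ⊕ Z)    ≈⟨ ·-distribˡ-⊕ X Y Z ⟩
    X · Y ⊕ X · Z  ≈⟨ ⊕-cong XY≋YX XZ≋ZX ⟩
    Y · X ⊕ Z · X  ≈⟨ ·-distribʳ-⊕ X Y Z ⟨
    (Y ⊕ Z) · X    ∎
    where open ≋-Reasoning

  ᵀ-comm-symmetric : ∀ {n} {A C : Mat n n} → Symmetric C → A · C ≋ C · A → A ᵀ · C ≋ C · A ᵀ
  ᵀ-comm-symmetric {A = A} {C} C-sym AC≋CA = begin
    A ᵀ · C      ≈⟨ ·-cong ≋-refl C-sym ⟨
    A ᵀ · C ᵀ    ≈⟨ ᵀ-· C A ⟨
    (C · A) ᵀ    ≈⟨ (λ i j → AC≋CA j i) ⟨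
    (A · C) ᵀ    ≈⟨ ᵀ-· A C ⟩
    C ᵀ · A ᵀ    ≈⟨ ·-cong C-sym ≋-refl ⟩
    C · A ᵀ      ∎
    where open ≋-Reasoning

  ↑ˡ≢↑ʳ : ∀ {m n} (i : Fin m) (j : Fin n) → i ↑ˡ n ≢ m ↑ʳ j
  ↑ˡ≢↑ʳ {m} {n} i j i≡j with ≡.trans (≡.sym (splitAt-↑ˡ m i n)) (≡.trans (≡.cong (splitAt m) i≡j) (splitAt-↑ʳ m n j))
  ... | ()

  blocks : ∀ {m n p q} → Mat m p → Mat m q → Mat n p → Mat n q → Mat (m +ℕ n) (p +ℕ q)
  blocks {m} {p = p} X₁₁ X₁₂ X₂₁ X₂₂ i j with splitAt m i | splitAt p j
  ... | inj₁ a | inj₁ b = X₁₁ a b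
  ... | inj₁ a | inj₂ b = X₁₂ a b
  ... | inj₂ a | inj₁ b = X₂₁ a b
  ... | inj₂ a | inj₂ b = X₂₂ a b

  ↑-elim : ∀ {m n a} {P : Fin (m +ℕ n) → Set a} → (∀ i → P (i ↑ˡ n)) → (∀ i → P (m ↑ʳ i)) → ∀ i → P i
  ↑-elim {m} {P = P} P↑ˡ P↑ʳ i with splitAt m i in i≡
  ... | inj₁ a = ≡.subst P (splitAt⁻¹-↑ˡ i≡) (P↑ˡ a)
  ... | inj₂ a = ≡.subst P (splitAt⁻¹-↑ʳ i≡) (P↑ʳ a)

  block-elim : ∀ {m n p q a} {P : Fin (m +ℕ n) → Fin (p +ℕ q) → Set a} →
               (∀ i j → P (i ↑ˡ n) (j ↑ˡ q)) → (∀ i j → P (i ↑ˡ n) (p ↑ʳ j)) →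
               (∀ i j → P (m ↑ʳ i) (j ↑ˡ q)) → (∀ i j → P (m ↑ʳ i) (p ↑ʳ j)) → ∀ i j → P i j
  block-elim P₁₁ P₁₂ P₂₁ P₂₂ = ↑-elim (λ a → ↑-elim (P₁₁ a) (P₁₂ a)) (λ a → ↑-elim (P₂₁ a) (P₂₂ a))

  module Blocks {m n p q} (X₁₁ : Mat m p) (X₁₂ : Mat m q) (X₂₁ : Mat n p) (X₂₂ : Mat n q) where
    entry₁₁ : ∀ a b → blocks X₁₁ X₁₂ X₂₁ X₂₂ (a ↑ˡ n) (b ↑ˡ q) ≡ X₁₁ a b
    entry₁₁ a b rewrite splitAt-↑ˡ m a n | splitAt-↑ˡ p b q = ≡.refl

    entry₁₂ : ∀ a b → blocks X₁₁ X₁₂ X₂₁ X₂₂ (a ↑ˡ n) (p ↑ʳ b) ≡ X₁₂ a b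
    entry₁₂ a b rewrite splitAt-↑ˡ m a n | splitAt-↑ʳ p q b = ≡.refl

    entry₂₁ : ∀ a b → blocks X₁₁ X₁₂ X₂₁ X₂₂ (m ↑ʳ a) (b ↑ˡ q) ≡ X₂₁ a b
    entry₂₁ a b rewrite splitAt-↑ʳ m n a | splitAt-↑ˡ p b q = ≡.refl

    entry₂₂ : ∀ a b → blocks X₁₁ X₁₂ X₂₁ X₂₂ (m ↑ʳ a) (p ↑ʳ b) ≡ X₂₂ a b
    entry₂₂ a b rewrite splitAt-↑ʳ m n a | splitAt-↑ʳ p q b = ≡.refl

    ≋-blocks : ∀ {X : Mat (m +ℕ n) (p +ℕ q)} →
               (∀ a b → X (a ↑ˡ n) (b ↑ˡ q) ≈ X₁₁ a b) → (∀ a b → X (a ↑ˡ n) (p ↑ʳ b) ≈ X₁₂ a b) →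
               (∀ a b → X (m ↑ʳ a) (b ↑ˡ q) ≈ X₂₁ a b) → (∀ a b → X (m ↑ʳ a) (p ↑ʳ b) ≈ X₂₂ a b) →
               X ≋ blocks X₁₁ X₁₂ X₂₁ X₂₂
    ≋-blocks X₁₁≈ X₁₂≈ X₂₁≈ X₂₂≈ = block-elim
      (λ a b → trans (X₁₁≈ a b) (reflexive (≡.sym (entry₁₁ a b))))
      (λ a b → trans (X₁₂≈ a b) (reflexive (≡.sym (entry₁₂ a b))))
      (λ a b → trans (X₂₁≈ a b) (reflexive (≡.sym (entry₂₁ a b))))
      (λ a b → trans (X₂₂≈ a b) (reflexive (≡.sym (entry₂₂ a b))))

  blocks-cong : ∀ {m n p q} {X₁₁ Y₁₁ : Mat m p} {X₁₂ Y₁₂ : Mat m q} {X₂₁ Y₂₁ : Mat n p} {X₂₂ Y₂₂ : Mat n q} →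
                X₁₁ ≋ Y₁₁ → X₁₂ ≋ Y₁₂ → X₂₁ ≋ Y₂₁ → X₂₂ ≋ Y₂₂ →
                blocks X₁₁ X₁₂ X₂₁ X₂₂ ≋ blocks Y₁₁ Y₁₂ Y₂₁ Y₂₂
  blocks-cong {X₁₁ = X₁₁} {Y₁₁} {X₁₂} {Y₁₂} {X₂₁} {Y₂₁} {X₂₂} {Y₂₂} X₁₁≋ X₁₂≋ X₂₁≋ X₂₂≋ = Y.≋-blocks
    (λ a b → trans (reflexive (X.entry₁₁ a b)) (X₁₁≋ a b))
    (λ a b → trans (reflexive (X.entry₁₂ a b)) (X₁₂≋ a b))
    (λ a b → trans (reflexive (X.entry₂₁ a b)) (X₂₁≋ a b))
    (λ a b → trans (reflexive (X.entry₂₂ a b)) (X₂₂≋ a b))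
    where
    module X = Blocks X₁₁ X₁₂ X₂₁ X₂₂
    module Y = Blocks Y₁₁ Y₁₂ Y₂₁ Y₂₂

  blocks-ᵀ : ∀ {m n p q} (X₁₁ : Mat m p) (X₁₂ : Mat m q) (X₂₁ : Mat n p) (X₂₂ : Mat n q) →
             blocks X₁₁ X₁₂ X₂₁ X₂₂ ᵀ ≋ blocks (X₁₁ ᵀ) (X₂₁ ᵀ) (X₁₂ ᵀ) (X₂₂ ᵀ)
  blocks-ᵀ X₁₁ X₁₂ X₂₁ X₂₂ = Blocks.≋-blocks (X₁₁ ᵀ) (X₂₁ ᵀ) (X₁₂ ᵀ) (X₂₂ ᵀ)
    (λ a b → reflexive (X.entry₁₁ b a)) (λ a b → reflexive (X.entry₂₁ b a))
    (λ a b → reflexive (X.entry₁₂ b a)) (λ a b → reflexive (X.entry₂₂ b a))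
    where module X = Blocks X₁₁ X₁₂ X₂₁ X₂₂

  Id-blocks : ∀ m n → Id (m +ℕ n) ≋ blocks (Id m) 𝟎 𝟎 (Id n)
  Id-blocks m n = Blocks.≋-blocks (Id m) 𝟎 𝟎 (Id n)
    (λ a b → reflexive (Id-reindex (_↑ˡ n) (↑ˡ-injective n) a b))
    (λ a b → reflexive (Id-offdiag (↑ˡ≢↑ʳ a b)))
    (λ a b → reflexive (Id-offdiag (λ e → ↑ˡ≢↑ʳ b a (≡.sym e))))
    (λ a b → reflexive (Id-reindex (m ↑ʳ_) (↑ʳ-injective m) a b))

  blocks-· : ∀ {m n p q u v} (X₁₁ : Mat m p) (X₁₂ : Mat m q) (X₂₁ : Mat n p) (X₂₂ : Mat n q)
             (Y₁₁ : Mat p u) (Y₁₂ : Mat p v) (Y₂₁ : Mat q u) (Y₂₂ : Mat q v) →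
             blocks X₁₁ X₁₂ X₂₁ X₂₂ · blocks Y₁₁ Y₁₂ Y₂₁ Y₂₂ ≋
             blocks (X₁₁ · Y₁₁ ⊕ X₁₂ · Y₂₁) (X₁₁ · Y₁₂ ⊕ X₁₂ · Y₂₂)
                    (X₂₁ · Y₁₁ ⊕ X₂₂ · Y₂₁) (X₂₁ · Y₁₂ ⊕ X₂₂ · Y₂₂)
  blocks-· {p = p} {q} X₁₁ X₁₂ X₂₁ X₂₂ Y₁₁ Y₁₂ Y₂₁ Y₂₂ = Blocks.≋-blocks _ _ _ _
    (λ a b → split-product (λ t → ≡.cong₂ _*_ (X.entry₁₁ a t) (Y.entry₁₁ t b)) (λ t → ≡.cong₂ _*_ (X.entry₁₂ a t) (Y.entry₂₁ t b)))
    (λ a b → split-product (λ t → ≡.cong₂ _*_ (X.entry₁₁ a t) (Y.entry₁₂ t b)) (λ t → ≡.cong₂ _*_ (X.entry₁₂ a t) (Y.entry₂₂ t b)))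
    (λ a b → split-product (λ t → ≡.cong₂ _*_ (X.entry₂₁ a t) (Y.entry₁₁ t b)) (λ t → ≡.cong₂ _*_ (X.entry₂₂ a t) (Y.entry₂₁ t b)))
    (λ a b → split-product (λ t → ≡.cong₂ _*_ (X.entry₂₁ a t) (Y.entry₁₂ t b)) (λ t → ≡.cong₂ _*_ (X.entry₂₂ a t) (Y.entry₂₂ t b)))
    where
    module X = Blocks X₁₁ X₁₂ X₂₁ X₂₂
    module Y = Blocks Y₁₁ Y₁₂ Y₂₁ Y₂₂
    split-product : ∀ {i j} {f : Fin p → Carrier} {g : Fin q → Carrier} →
      (∀ t → blocks X₁₁ X₁₂ X₂₁ X₂₂ i (t ↑ˡ q) * blocks Y₁₁ Y₁₂ Y₂₁ Y₂₂ (t ↑ˡ q) j ≡ f t) →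
      (∀ t → blocks X₁₁ X₁₂ X₂₁ X₂₂ i (p ↑ʳ t) * blocks Y₁₁ Y₁₂ Y₂₁ Y₂₂ (p ↑ʳ t) j ≡ g t) →
      (blocks X₁₁ X₁₂ X₂₁ X₂₂ · blocks Y₁₁ Y₁₂ Y₂₁ Y₂₂) i j ≈ sum f + sum g
    split-product {i} {j} f≡ g≡ =
      trans (sum-↑ p (λ t → blocks X₁₁ X₁₂ X₂₁ X₂₂ i t * blocks Y₁₁ Y₁₂ Y₂₁ Y₂₂ t j))
            (reflexive (≡.cong₂ _+_ (sum-cong-≗ f≡) (sum-cong-≗ g≡)))

  module Circulant (n : ℕ) .{{_ : NonZero n}} where
    open Residues n

    circulant-comm : ∀ {A B : Mat n n} → D.IsCirculant R n A → D.IsCirculant R n B → A · B ≋ B · A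
    circulant-comm {A} {B} (a , A≈a) (b , B≈b) i j = begin
      sum (λ t → A i t * B t j)                       ≈⟨ sum-cong-≋ (λ t → *-cong (A≈a i t) (B≈b t j)) ⟩
      sum (λ t → a (t ⊟ i) * b (j ⊟ t))               ≈⟨ ∑-permute (λ t → a (t ⊟ i) * b (j ⊟ t)) ρ ⟩
      sum (λ t → a (reflect i j t ⊟ i) * b (j ⊟ reflect i j t))
        ≡⟨ sum-cong-≗ (λ t → ≡.cong₂ (λ u v → a u * b v) (reflect-⊟ˡ i j t) (reflect-⊟ʳ i j t)) ⟩
      sum (λ t → a (j ⊟ t) * b (t ⊟ i))               ≈⟨ sum-cong-≋ (λ t → *-comm (a (j ⊟ t)) (b (t ⊟ i))) ⟩
      sum (λ t → b (t ⊟ i) * a (j ⊟ t))               ≈⟨ sum-cong-≋ (λ t → *-cong (B≈b i t) (A≈a t j)) ⟨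
      sum (λ t → B i t * A t j)                       ∎
      where
      open ≈-Reasoning
      ρ = permutation (reflect i j) (reflect i j) (reflect-involutive i j) (reflect-involutive i j)

    circulant-ᵀ : ∀ {A : Mat n n} → D.IsCirculant R n A → D.IsCirculant R n (A ᵀ)
    circulant-ᵀ (a , A≈a) = (λ t → a [ neg t ]) , λ i j → trans (A≈a j i) (reflexive (≡.cong a (⊟-anticomm i j)))

    circulant-normal : ∀ {A : Mat n n} → D.IsCirculant R n A → A ᵀ · A ≋ A · A ᵀ
    circulant-normal A-circ = circulant-comm (circulant-ᵀ A-circ) A-circ

    reverseCirculant-symmetric : ∀ {C : Mat n n} → D.IsReverseCirculant R n C → Symmetric C
    reverseCirculant-symmetric (c , C≈c) i j = trans (C≈c j i) (trans (reflexive (≡.cong c (⊞-comm i j))) (sym (C≈c i j)))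

    circulant·reverseCirculant-symmetric : ∀ {B C : Mat n n} → D.IsCirculant R n B → D.IsReverseCirculant R n C →
                                           Symmetric (B · C)
    circulant·reverseCirculant-symmetric {B} {C} (b , B≈b) (c , C≈c) j i = begin
      sum (λ t → B i t * C t j)                       ≈⟨ sum-cong-≋ (λ t → *-cong (B≈b i t) (C≈c t j)) ⟩
      sum (λ t → b (t ⊟ i) * c (j ⊞ t))
        ≡⟨ sum-cong-≗ (λ t → ≡.cong₂ (λ u v → b u * c v) (translate-⊟ i j t) (translate-⊞ i j t)) ⟨
      sum (λ t → b (translate i j t ⊟ j) * c (i ⊞ translate i j t))
                                                      ≈⟨ ∑-permute (λ t → b (t ⊟ j) * c (i ⊞ t)) τ ⟨
      sum (λ t → b (t ⊟ j) * c (i ⊞ t))               ≈⟨ sum-cong-≋ (λ t → *-cong (B≈b j t) (C≈c t i)) ⟨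
      sum (λ t → B j t * C t i)                       ∎
      where
      open ≈-Reasoning
      τ = permutation (translate i j) (translate j i) (translate-inverse j i) (translate-inverse i j)

  rightHalf : ∀ {n} → Mat n n → Mat n n → Mat n n → Mat (n +ℕ n) (n +ℕ n)
  rightHalf A B C = blocks A (B ⊕ C) (B ᵀ ⊕ C) (A ᵀ)

  genMat-↑ˡ : ∀ n (A B C : Mat n n) i j → D.genMat R n A B C i (j ↑ˡ (n +ℕ n)) ≡ Id (n +ℕ n) i j
  genMat-↑ˡ n A B C i j rewrite splitAt-↑ˡ (n +ℕ n) j (n +ℕ n) = ≡.refl

  genMat-↑ʳ : ∀ n (A B C : Mat n n) i j → D.genMat R n A B C i ((n +ℕ n) ↑ʳ j) ≡ rightHalf A B C i j
  genMat-↑ʳ n A B C i j rewrite splitAt-↑ʳ (n +ℕ n) (n +ℕ n) j with splitAt n i | splitAt n j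
  ... | inj₁ _ | inj₁ _ = ≡.refl
  ... | inj₁ _ | inj₂ _ = ≡.refl
  ... | inj₂ _ | inj₁ _ = ≡.refl
  ... | inj₂ _ | inj₂ _ = ≡.refl

  rightHalf-ᵀ : ∀ {n} {A B C : Mat n n} → Symmetric C → rightHalf A B C ᵀ ≋ rightHalf (A ᵀ) B C
  rightHalf-ᵀ {A = A} {B} {C} C-sym = ≋-trans (blocks-ᵀ A (B ⊕ C) (B ᵀ ⊕ C) (A ᵀ))
    (blocks-cong ≋-refl (⊕-cong ≋-refl C-sym) (⊕-cong ≋-refl C-sym) ≋-refl)

  module Characteristic2 (char2 : D.Characteristic2 R) where
    import Algebra.Solver.CommutativeMonoid +-commutativeMonoid as +-Solver
    open +-Solver using (solve; _⊜_) renaming (_⊕_ to _:+_)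

    x+x≈0 : ∀ x → x + x ≈ 0#
    x+x≈0 x = begin
      x + x              ≈⟨ +-cong (*-identityʳ x) (*-identityʳ x) ⟨
      x * 1# + x * 1#    ≈⟨ distribˡ x 1# 1# ⟨
      x * (1# + 1#)      ≈⟨ *-congˡ char2 ⟩
      x * 0#             ≈⟨ zeroʳ x ⟩
      0#                 ∎
      where open ≈-Reasoning

    x+y≈0⇒x≈y : ∀ {x y} → x + y ≈ 0# → x ≈ y
    x+y≈0⇒x≈y {x} {y} x+y≈0 = begin
      x              ≈⟨ +-identityʳ x ⟨
      x + 0#         ≈⟨ +-congˡ (x+x≈0 y) ⟨
      x + (y + y)    ≈⟨ +-assoc x y y ⟨
      (x + y) + y    ≈⟨ +-congʳ x+y≈0 ⟩
      0# + y         ≈⟨ +-identityˡ y ⟩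
      y              ∎
      where open ≈-Reasoning

    x+[[y+z]+[z+w]]≈[x+y]+w : ∀ x y z w → x + ((y + z) + (z + w)) ≈ (x + y) + w
    x+[[y+z]+[z+w]]≈[x+y]+w x y z w = begin
      x + ((y + z) + (z + w))     ≈⟨ solve 4 (λ x y z w → x :+ ((y :+ z) :+ (z :+ w)) ⊜ ((x :+ y) :+ w) :+ (z :+ z)) refl x y z w ⟩
      ((x + y) + w) + (z + z)     ≈⟨ +-congˡ (x+x≈0 z) ⟩
      ((x + y) + w) + 0#          ≈⟨ +-identityʳ _ ⟩
      (x + y) + w                 ∎
      where open ≈-Reasoning

    module SystematicCode {m} (G : Mat m (m +ℕ m)) (M : Mat m m)
      (G-left : ∀ i j → G i (j ↑ˡ m) ≈ Id m i j) (G-right : ∀ i j → G i (m ↑ʳ j) ≈ M i j)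
      (M·Mᵀ≈Id : M · M ᵀ ≋ Id m) (Mᵀ·M≈Id : M ᵀ · M ≋ Id m) where

      ⟨x,Gᵢ⟩ : ∀ x i → ⟨ x , G i ⟩ ≈ x (i ↑ˡ m) + sum (λ l → x (m ↑ʳ l) * M i l)
      ⟨x,Gᵢ⟩ x i = begin
        sum (λ j → x j * G i j)
          ≈⟨ sum-↑ m (λ j → x j * G i j) ⟩
        sum (λ l → x (l ↑ˡ m) * G i (l ↑ˡ m)) + sum (λ l → x (m ↑ʳ l) * G i (m ↑ʳ l))
          ≈⟨ +-cong (sum-cong-≋ (λ l → *-congˡ (trans (G-left i l) (reflexive (Id-symmetric i l)))))
                    (sum-cong-≋ (λ l → *-congˡ (G-right i l))) ⟩
        sum (λ l → x (l ↑ˡ m) * Id m l i) + sum (λ l → x (m ↑ʳ l) * M i l)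
          ≈⟨ +-congʳ (sum-Idʳ i (λ l → x (l ↑ˡ m))) ⟩
        x (i ↑ˡ m) + sum (λ l → x (m ↑ʳ l) * M i l) ∎
        where open ≈-Reasoning

      rows-orthogonal : ∀ l i → ⟨ G l , G i ⟩ ≈ 0#
      rows-orthogonal l i = begin
        ⟨ G l , G i ⟩                                       ≈⟨ ⟨x,Gᵢ⟩ (G l) i ⟩
        G l (i ↑ˡ m) + sum (λ t → G l (m ↑ʳ t) * M i t)     ≈⟨ +-cong (G-left l i) (sum-cong-≋ (λ t → *-congʳ (G-right l t))) ⟩
        Id m l i + (M · M ᵀ) l i                            ≈⟨ +-congˡ (M·Mᵀ≈Id l i) ⟩
        Id m l i + Id m l i                                 ≈⟨ x+x≈0 (Id m l i) ⟩
        0#                                                  ∎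
        where open ≈-Reasoning

      row∈rowSpan : ∀ i → D.rowSpan R G (G i)
      row∈rowSpan i = Id m i , λ j → sym (sum-Idˡ i (λ l → G l j))

      ⊥rows⇒∈dual : ∀ x → (∀ i → ⟨ x , G i ⟩ ≈ 0#) → D.dual R (D.rowSpan R G) x
      ⊥rows⇒∈dual x x⊥G y (μ , y≈μG) = begin
        sum (λ j → x j * y j)                          ≈⟨ sum-cong-≋ (λ j → *-congˡ (y≈μG j)) ⟩
        sum (λ j → x j * sum (λ i → μ i * G i j))      ≈⟨ sum-cong-≋ (λ j → *-distribˡ-sum (x j) (λ i → μ i * G i j)) ⟩
        sum (λ j → sum (λ i → x j * (μ i * G i j)))    ≈⟨ ∑-comm (λ j i → x j * (μ i * G i j)) ⟩
        sum (λ i → sum (λ j → x j * (μ i * G i j)))    ≈⟨ sum-cong-≋ (λ i → sum-cong-≋ (λ j → x∙yz≈y∙xz (x j) (μ i) (G i j))) ⟩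
        sum (λ i → sum (λ j → μ i * (x j * G i j)))    ≈⟨ sum-cong-≋ (λ i → *-distribˡ-sum (μ i) (λ j → x j * G i j)) ⟨
        sum (λ i → μ i * ⟨ x , G i ⟩)                  ≈⟨ sum-zero (λ i → μ i * ⟨ x , G i ⟩) (λ i → trans (*-congˡ (x⊥G i)) (zeroʳ (μ i))) ⟩
        0#                                             ∎
        where open ≈-Reasoning

      -- The coefficients are the first half x₁ of x: orthogonality to the rows gives
      -- x₁ = M x₂, hence Mᵀ x₁ = x₂.
      dual⊆rowSpan : ∀ x → D.dual R (D.rowSpan R G) x → D.rowSpan R G x
      dual⊆rowSpan x x∈dual = x₁ , ↑-elim column₁ column₂
        where
        open ≈-Reasoning
        x₁ x₂ : D.Vect R m
        x₁ i = x (i ↑ˡ m)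
        x₂ l = x (m ↑ʳ l)
        x₁≈Mx₂ : ∀ i → x₁ i ≈ sum (λ l → x₂ l * M i l)
        x₁≈Mx₂ i = x+y≈0⇒x≈y (trans (sym (⟨x,Gᵢ⟩ x i)) (x∈dual (G i) (row∈rowSpan i)))
        column₁ : ∀ r → x (r ↑ˡ m) ≈ sum (λ i → x₁ i * G i (r ↑ˡ m))
        column₁ r = sym (trans (sum-cong-≋ (λ i → *-congˡ (G-left i r))) (sum-Idʳ r x₁))
        column₂ : ∀ r → x (m ↑ʳ r) ≈ sum (λ i → x₁ i * G i (m ↑ʳ r))
        column₂ r = sym (begin
          sum (λ i → x₁ i * G i (m ↑ʳ r))                   ≈⟨ sum-cong-≋ (λ i → *-cong (x₁≈Mx₂ i) (G-right i r)) ⟩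
          sum (λ i → sum (λ l → x₂ l * M i l) * M i r)      ≈⟨ sum-cong-≋ (λ i → *-distribʳ-sum (M i r) (λ l → x₂ l * M i l)) ⟩
          sum (λ i → sum (λ l → x₂ l * M i l * M i r))      ≈⟨ ∑-comm (λ i l → x₂ l * M i l * M i r) ⟩
          sum (λ l → sum (λ i → x₂ l * M i l * M i r))      ≈⟨ sum-cong-≋ (λ l → sum-cong-≋ (λ i → *-assoc (x₂ l) (M i l) (M i r))) ⟩
          sum (λ l → sum (λ i → x₂ l * (M i l * M i r)))    ≈⟨ sum-cong-≋ (λ l → *-distribˡ-sum (x₂ l) (λ i → M i l * M i r)) ⟨
          sum (λ l → x₂ l * (M ᵀ · M) l r)                  ≈⟨ sum-cong-≋ (λ l → *-congˡ (Mᵀ·M≈Id l r)) ⟩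
          sum (λ l → x₂ l * Id m l r)                       ≈⟨ sum-Idʳ r x₂ ⟩
          x₂ r                                              ∎)

      selfDual : D.IsSelfDual R (D.rowSpan R G)
      selfDual x = rowSpan⊆dual , dual⊆rowSpan x
        where
        rowSpan⊆dual : D.rowSpan R G x → D.dual R (D.rowSpan R G) x
        rowSpan⊆dual x∈C = ⊥rows⇒∈dual x (λ i →
          trans (sum-cong-≋ (λ j → *-comm (x j) (G i j))) (⊥rows⇒∈dual (G i) (λ l → rows-orthogonal i l) x x∈C))

    commuting⇒X·Y⊕Y·X≈𝟎 : ∀ {n} {X Y : Mat n n} → X · Y ≋ Y · X → X · Y ⊕ Y · X ≋ 𝟎
    commuting⇒X·Y⊕Y·X≈𝟎 {X = X} {Y} XY≋YX i j = trans (+-congʳ (XY≋YX i j)) (x+x≈0 ((Y · X) i j))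

    diagonalBlock≈Id : ∀ {n} {A B C : Mat n n} → Symmetric C → Symmetric (B · C) →
                       A · A ᵀ ⊕ B · B ᵀ ⊕ C · C ≋ Id n → A · A ᵀ ⊕ (B ⊕ C) · (B ᵀ ⊕ C) ≋ Id n
    diagonalBlock≈Id {n} {A} {B} {C} C-sym BC-sym gram≈Id = begin
      A · A ᵀ ⊕ (B ⊕ C) · (B ᵀ ⊕ C)                          ≈⟨ ⊕-cong ≋-refl expand ⟩
      A · A ᵀ ⊕ ((B · B ᵀ ⊕ B · C) ⊕ (C · B ᵀ ⊕ C · C))       ≈⟨ ⊕-cong ≋-refl (⊕-cong ≋-refl (⊕-cong C·Bᵀ≋B·C ≋-refl)) ⟩
      A · A ᵀ ⊕ ((B · B ᵀ ⊕ B · C) ⊕ (B · C ⊕ C · C))         ≈⟨ (λ i j → x+[[y+z]+[z+w]]≈[x+y]+w _ _ _ _) ⟩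
      A · A ᵀ ⊕ B · B ᵀ ⊕ C · C                               ≈⟨ gram≈Id ⟩
      Id n                                                    ∎
      where
      open ≋-Reasoning
      expand : (B ⊕ C) · (B ᵀ ⊕ C) ≋ (B · B ᵀ ⊕ B · C) ⊕ (C · B ᵀ ⊕ C · C)
      expand = ≋-trans (·-distribʳ-⊕ (B ᵀ ⊕ C) B C) (⊕-cong (·-distribˡ-⊕ B (B ᵀ) C) (·-distribˡ-⊕ C (B ᵀ) C))
      C·Bᵀ≋B·C : C · B ᵀ ≋ B · C
      C·Bᵀ≋B·C = begin
        C · B ᵀ      ≈⟨ ·-cong C-sym ≋-refl ⟨
        C ᵀ · B ᵀ    ≈⟨ ᵀ-· B C ⟨
        (B · C) ᵀ    ≈⟨ BC-sym ⟩
        B · C        ∎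

    rightHalf-orthogonal : ∀ {n} {A B C : Mat n n} → Symmetric C → Symmetric (B · C) → Symmetric (B ᵀ · C) →
                           A · A ᵀ ⊕ B · B ᵀ ⊕ C · C ≋ Id n → A ᵀ · A ⊕ B ᵀ · B ⊕ C · C ≋ Id n →
                           A · (B ⊕ C) ≋ (B ⊕ C) · A → A ᵀ · (B ᵀ ⊕ C) ≋ (B ᵀ ⊕ C) · A ᵀ →
                           rightHalf A B C · rightHalf A B C ᵀ ≋ Id (n +ℕ n)
    rightHalf-orthogonal {n} {A} {B} {C} C-sym BC-sym BᵀC-sym gram≈Id gramᵀ≈Id A-comm Aᵀ-comm = begin
      rightHalf A B C · rightHalf A B C ᵀ        ≈⟨ ·-cong ≋-refl (rightHalf-ᵀ C-sym) ⟩
      rightHalf A B C · rightHalf (A ᵀ) B C      ≈⟨ blocks-· A (B ⊕ C) (B ᵀ ⊕ C) (A ᵀ) (A ᵀ) (B ⊕ C) (B ᵀ ⊕ C) A ⟩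
      blocks (A · A ᵀ ⊕ (B ⊕ C) · (B ᵀ ⊕ C)) (A · (B ⊕ C) ⊕ (B ⊕ C) · A)
             ((B ᵀ ⊕ C) · A ᵀ ⊕ A ᵀ · (B ᵀ ⊕ C)) ((B ᵀ ⊕ C) · (B ⊕ C) ⊕ A ᵀ · A)
        ≈⟨ blocks-cong (diagonalBlock≈Id C-sym BC-sym gram≈Id)
                       (commuting⇒X·Y⊕Y·X≈𝟎 A-comm)
                       (commuting⇒X·Y⊕Y·X≈𝟎 (≋-sym Aᵀ-comm))
                       (≋-trans (⊕-comm _ _) (diagonalBlock≈Id C-sym BᵀC-sym gramᵀ≈Id)) ⟩
      blocks (Id n) 𝟎 𝟎 (Id n)                   ≈⟨ Id-blocks n n ⟨
      Id (n +ℕ n)                                ∎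
      where open ≋-Reasoning

    circulant-rightHalf-orthogonal : ∀ {n} .{{_ : NonZero n}} {A B C : Mat n n} →
      D.IsCirculant R n A → D.IsCirculant R n B → D.IsReverseCirculant R n C →
      A · A ᵀ ⊕ B · B ᵀ ⊕ C · C ≋ Id n → A · C ≋ C · A →
      rightHalf A B C · rightHalf A B C ᵀ ≋ Id (n +ℕ n)
    circulant-rightHalf-orthogonal {n} A-circ B-circ C-rev gram≈Id AC≋CA = rightHalf-orthogonal C-sym
      (circulant·reverseCirculant-symmetric B-circ C-rev)
      (circulant·reverseCirculant-symmetric (circulant-ᵀ B-circ) C-rev)
      gram≈Id
      (≋-trans (⊕-cong (⊕-cong (circulant-normal A-circ) (circulant-normal B-circ)) ≋-refl) gram≈Id)
      (·-comm-⊕ (circulant-comm A-circ B-circ) AC≋CA)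
      (·-comm-⊕ (circulant-comm (circulant-ᵀ A-circ) (circulant-ᵀ B-circ)) (ᵀ-comm-symmetric C-sym AC≋CA))
      where
      open Circulant n
      C-sym = reverseCirculant-symmetric C-rev

    circulant-rightHalfᵀ-orthogonal : ∀ {n} .{{_ : NonZero n}} {A B C : Mat n n} →
      D.IsCirculant R n A → D.IsCirculant R n B → D.IsReverseCirculant R n C →
      A · A ᵀ ⊕ B · B ᵀ ⊕ C · C ≋ Id n → A · C ≋ C · A →
      rightHalf A B C ᵀ · rightHalf A B C ≋ Id (n +ℕ n)
    circulant-rightHalfᵀ-orthogonal {n} {A} {B} {C} A-circ B-circ C-rev gram≈Id AC≋CA = begin
      rightHalf A B C ᵀ · rightHalf A B C
        ≈⟨ ·-cong (rightHalf-ᵀ C-sym) (≋-sym (rightHalf-ᵀ {A = A ᵀ} C-sym)) ⟩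
      rightHalf (A ᵀ) B C · rightHalf (A ᵀ) B C ᵀ
        ≈⟨ circulant-rightHalf-orthogonal (circulant-ᵀ A-circ) B-circ C-rev
             (≋-trans (⊕-cong (⊕-cong (circulant-normal A-circ) ≋-refl) ≋-refl) gram≈Id)
             (ᵀ-comm-symmetric C-sym AC≋CA) ⟩
      Id (n +ℕ n) ∎
      where
      open Circulant n
      open ≋-Reasoning
      C-sym = reverseCirculant-symmetric C-rev

open D

theorem3p1 : ∀ {c ℓ : Level} (R : CommutativeRing c ℓ) → IsFrobenius R → Characteristic2 R
    → (k : ℕ) → let n = suc k in
      (A B C : Mat R n n)
    → IsCirculant R n A → IsCirculant R n B → IsReverseCirculant R n C
    → _≈ᴹ_ R (_⊕_ R (_⊕_ R (_·_ R A (_ᵀ R A)) (_·_ R B (_ᵀ R B))) (_·_ R C C)) (Id R n)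
    → _≈ᴹ_ R (_·_ R A C) (_·_ R C A)
    → IsSelfDual R (rowSpan R (genMat R n A B C))
theorem3p1 R _ char2 k A B C A-circ B-circ C-rev gram≈Id AC≈CA =
  SystematicCode.selfDual (genMat R n A B C) (rightHalf A B C)
    (λ i j → reflexive (genMat-↑ˡ n A B C i j))
    (λ i j → reflexive (genMat-↑ʳ n A B C i j))
    (circulant-rightHalf-orthogonal A-circ B-circ C-rev gram≈Id AC≈CA)
    (circulant-rightHalfᵀ-orthogonal A-circ B-circ C-rev gram≈Id AC≈CA)
  where
  n = suc k
  open CommutativeRing R using (reflexive)
  open Matrices R using (rightHalf; genMat-↑ˡ; genMat-↑ʳ; module Characteristic2)
  open Characteristic2 char2 using (module SystematicCode; circulant-rightHalf-orthogonal; circulant-rightHalfᵀ-orthogonal)
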